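{- Let $D$ be a $k$-fold circuit in a matroid $\mathcal{M}$ whose principal partition $\{A_1,A_2,\ldots,A_k\}$ has exactly $k$ parts. Then each $A_i$ is a circuit of $\mathcal{M}$ and $\mathcal{M}|_D=\mathcal{M}|_{A_1}\oplus\mathcal{M}|_{A_2}\oplus\cdots\oplus\mathcal{M}|_{A_k}$.
   Context: Matroids have finite ground sets, rank $r$. A cyclic set is a set $D$ with $r(D-e)=r(D)$ for all $e\in D$; a $k$-fold circuit is a cyclic set with $r(D)=|D|-k$. The principal partition of a $k$-fold circuit $D$ is $\{D\setminus B: B\subseteq D\text{ a }(k-1)\text{ -fold circuit}\}$, a partition of $D$ into at least $k$ parts. -}

module Defs where

open import Data.Nat using (ℕ; zero; suc; _+_; _≤_; _<_)
open import Data.Fin using (Fin)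
open import Data.Fin.Subset using (Subset; _⊆_; _⊂_; _∈_; _∩_; _∪_; _─_; _-_; ∣_∣)
open import Data.Product using (Σ; _×_; ∃; ∃-syntax)
open import Relation.Binary.PropositionalEquality using (_≡_; _≢_)
open import Relation.Nullary using (¬_)

record Matroid (n : ℕ) : Set where
  field
    r         : Subset n → ℕ
    r-bounded : ∀ X → r X ≤ ∣ X ∣
    r-mono    : ∀ X Y → X ⊆ Y → r X ≤ r Y
    r-submod  : ∀ X Y → r (X ∪ Y) + r (X ∩ Y) ≤ r X + r Y

module _ {n : ℕ} (M : Matroid n) where
  open Matroid M

  Independent : Subset n → Set
  Independent X = r X ≡ ∣ X ∣

  Circuit : Subset n → Set
  Circuit C = ¬ Independent C × (∀ X → X ⊂ C → Independent X)

  Cyclic : Subset n → Set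
  Cyclic D = ∀ e → e ∈ D → r (D - e) ≡ r D

  FoldCircuit : ℕ → Subset n → Set
  FoldCircuit k D = Cyclic D × r D + k ≡ ∣ D ∣

  -- X is a part of the principal partition of the (suc k)-fold circuit D:
  -- X = D \ B for some k-fold circuit B ⊆ D
  PrincipalPart : ℕ → Subset n → Subset n → Set
  PrincipalPart k D X = ∃[ B ] (B ⊆ D × FoldCircuit k B × X ≡ D ─ B)

sumFin : (m : ℕ) → (Fin m → ℕ) → ℕ
sumFin zero    f = 0
sumFin (suc m) f = f Fin.zero + sumFin m (λ i → f (Fin.suc i))

-- Work with the nullity ν(X) = |X| − r(X), which is monotone and supermodular.
-- Deleting an element x of the (k+1)-fold circuit D leaves a set of nullity k, whose
-- cyclic core is a k-fold circuit avoiding x; so the parts cover D. Two k-fold circuits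
-- avoiding x both have the maximal nullity inside D − x, and supermodularity forces them
-- to coincide; so the parts are disjoint. Since ν(A_i) + ν(D − A_i) ≤ ν(D), each part has
-- nullity at most 1, and the same bound inside D − y makes A_i − y independent. With
-- exactly k+1 disjoint parts, A_i is the intersection of the k complements of the other
-- parts, and supermodularity bounds its nullity below by 1; so A_i is a circuit.
-- Then Σ r(A_i) = |D| − (k+1) = r(D), and a family whose ranks add up to the rank of its
-- union splits the rank of every subset.
module Submission where

open import Defs
open import Data.Nat using (ℕ; zero; suc; _+_; _*_; _∸_; _≤_; z≤n)
open import Data.Nat.Properties
open import Algebra.Properties.CommutativeSemigroup +-commutativeSemigroup using (interchange)
open import Data.Fin using (Fin; zero; suc; punchIn; punchOut)
open import Data.Fin.Properties using (any?; punchIn-punchOut) renaming (_≟_ to _≟ᶠ_; suc-injective to suc-injectiveᶠ)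
open import Data.Fin.Subset
open import Data.Fin.Subset.Properties
open import Data.Fin.Subset.Induction using (⊂-wellFounded)
open import Data.List using (tabulate)
open import Data.Vec using ([]; _∷_; here; there)
open import Data.Product using (_×_; _,_; proj₁; proj₂; ∃-syntax)
open import Data.Sum using (inj₁; inj₂)
open import Function using (_∘_; _⇔_; mk⇔; Equivalence)
open import Function.Definitions using (Injective)
open import Induction.WellFounded using (Acc; acc)
open import Relation.Binary.PropositionalEquality
open import Relation.Nullary using (yes; no; contradiction)
open import Relation.Nullary.Decidable using (_×-dec_; ¬?)

private
  variable
    n m : ℕ
    p : Subset n
    x : Fin n

∣p∪q∣+∣p∩q∣≡∣p∣+∣q∣ : ∀ (p q : Subset n) → ∣ p ∪ q ∣ + ∣ p ∩ q ∣ ≡ ∣ p ∣ + ∣ q ∣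
∣p∪q∣+∣p∩q∣≡∣p∣+∣q∣ []            []            = refl
∣p∪q∣+∣p∩q∣≡∣p∣+∣q∣ (inside  ∷ p) (inside  ∷ q) =
  cong suc (trans (+-suc _ _) (trans (cong suc (∣p∪q∣+∣p∩q∣≡∣p∣+∣q∣ p q)) (sym (+-suc _ _))))
∣p∪q∣+∣p∩q∣≡∣p∣+∣q∣ (inside  ∷ p) (outside ∷ q) = cong suc (∣p∪q∣+∣p∩q∣≡∣p∣+∣q∣ p q)
∣p∪q∣+∣p∩q∣≡∣p∣+∣q∣ (outside ∷ p) (inside  ∷ q) =
  trans (cong suc (∣p∪q∣+∣p∩q∣≡∣p∣+∣q∣ p q)) (sym (+-suc _ _))
∣p∪q∣+∣p∩q∣≡∣p∣+∣q∣ (outside ∷ p) (outside ∷ q) = ∣p∪q∣+∣p∩q∣≡∣p∣+∣q∣ p q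

∣p─q∣+∣q∣≡∣p∣ : ∀ (p q : Subset n) → q ⊆ p → ∣ p ─ q ∣ + ∣ q ∣ ≡ ∣ p ∣
∣p─q∣+∣q∣≡∣p∣ []            []            _   = refl
∣p─q∣+∣q∣≡∣p∣ (s       ∷ p) (inside  ∷ q) q⊆p with q⊆p here
... | here = trans (+-suc _ _) (cong suc (∣p─q∣+∣q∣≡∣p∣ p q (drop-∷-⊆ q⊆p)))
∣p─q∣+∣q∣≡∣p∣ (inside  ∷ p) (outside ∷ q) q⊆p = cong suc (∣p─q∣+∣q∣≡∣p∣ p q (drop-∷-⊆ q⊆p))
∣p─q∣+∣q∣≡∣p∣ (outside ∷ p) (outside ∷ q) q⊆p = ∣p─q∣+∣q∣≡∣p∣ p q (drop-∷-⊆ q⊆p)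

∣p-x∣+1≡∣p∣ : x ∈ p → ∣ p - x ∣ + 1 ≡ ∣ p ∣
∣p-x∣+1≡∣p∣ {x = x} {p = p} x∈p = begin
  ∣ p - x ∣ + 1         ≡⟨ cong (∣ p - x ∣ +_) (∣⁅x⁆∣≡1 x) ⟨
  ∣ p - x ∣ + ∣ ⁅ x ⁆ ∣ ≡⟨ ∣p─q∣+∣q∣≡∣p∣ p ⁅ x ⁆ ⁅x⁆⊆p ⟩
  ∣ p ∣                 ∎
  where
  open ≡-Reasoning
  ⁅x⁆⊆p : ⁅ x ⁆ ⊆ p
  ⁅x⁆⊆p y∈⁅x⁆ = subst (_∈ p) (sym (x∈⁅y⁆⇒x≡y _ y∈⁅x⁆)) x∈p

x∈p─q⇒x∉q : ∀ (p q : Subset n) → x ∈ p ─ q → x ∉ q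
x∈p─q⇒x∉q (s ∷ p) (outside ∷ q) (there x∈p─q) (there x∈q) = x∈p─q⇒x∉q p q x∈p─q x∈q
x∈p─q⇒x∉q (s ∷ p) (inside  ∷ q) (there x∈p─q) (there x∈q) = x∈p─q⇒x∉q p q x∈p─q x∈q

x∈⋃⁺ : (A : Fin m → Subset n) (i : Fin m) → x ∈ A i → x ∈ ⋃ (tabulate A)
x∈⋃⁺ A zero    x∈A = x∈p∪q⁺ (inj₁ x∈A)
x∈⋃⁺ A (suc i) x∈A = x∈p∪q⁺ (inj₂ (x∈⋃⁺ (A ∘ suc) i x∈A))

x∈⋃⁻ : ∀ m (A : Fin m → Subset n) → x ∈ ⋃ (tabulate A) → ∃[ i ] x ∈ A i
x∈⋃⁻ zero    A x∈⊥ = contradiction x∈⊥ ∉⊥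
x∈⋃⁻ (suc m) A x∈⋃ with x∈p∪q⁻ (A zero) _ x∈⋃
... | inj₁ x∈A₀ = zero , x∈A₀
... | inj₂ x∈⋃′ with x∈⋃⁻ m (A ∘ suc) x∈⋃′
...   | i , x∈A = suc i , x∈A

x∈⋂⁻ : (B : Fin m → Subset n) → x ∈ ⋂ (tabulate B) → ∀ j → x ∈ B j
x∈⋂⁻ B x∈⋂ zero    = proj₁ (x∈p∩q⁻ (B zero) _ x∈⋂)
x∈⋂⁻ B x∈⋂ (suc j) = x∈⋂⁻ (B ∘ suc) (proj₂ (x∈p∩q⁻ (B zero) _ x∈⋂)) j

sumFin-mono-≤ : ∀ m {f g : Fin m → ℕ} → (∀ i → f i ≤ g i) → sumFin m f ≤ sumFin m g
sumFin-mono-≤ zero    f≤g = z≤n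
sumFin-mono-≤ (suc m) f≤g = +-mono-≤ (f≤g zero) (sumFin-mono-≤ m (f≤g ∘ suc))

sumFin-+ : ∀ m (f g : Fin m → ℕ) → sumFin m (λ i → f i + g i) ≡ sumFin m f + sumFin m g
sumFin-+ zero    f g = refl
sumFin-+ (suc m) f g = trans (cong (f zero + g zero +_) (sumFin-+ m (f ∘ suc) (g ∘ suc)))
                             (interchange (f zero) (g zero) _ _)

sumFin-const : ∀ m {f : Fin m → ℕ} {c} → (∀ i → f i ≡ c) → sumFin m f ≡ m * c
sumFin-const zero    f≡c = refl
sumFin-const (suc m) f≡c = cong₂ _+_ (f≡c zero) (sumFin-const m (f≡c ∘ suc))

Disjoint : (Fin m → Subset n) → Set
Disjoint A = ∀ i j x → x ∈ A i → x ∈ A j → i ≡ j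

sumFin-∣∣≤∣⋃∣ : ∀ m (A : Fin m → Subset n) → Disjoint A → sumFin m (∣_∣ ∘ A) ≤ ∣ ⋃ (tabulate A) ∣
sumFin-∣∣≤∣⋃∣ zero    A disj = z≤n
sumFin-∣∣≤∣⋃∣ {n} (suc m) A disj = begin
  ∣ A zero ∣ + sumFin m (∣_∣ ∘ A ∘ suc) ≤⟨ +-monoʳ-≤ ∣ A zero ∣ (sumFin-∣∣≤∣⋃∣ m (A ∘ suc) disj′) ⟩
  ∣ A zero ∣ + ∣ U ∣                    ≡⟨ ∣p∪q∣+∣p∩q∣≡∣p∣+∣q∣ (A zero) U ⟨
  ∣ A zero ∪ U ∣ + ∣ A zero ∩ U ∣       ≡⟨ cong (λ Z → ∣ A zero ∪ U ∣ + ∣ Z ∣) (Empty-unique A₀∩U-empty) ⟩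
  ∣ A zero ∪ U ∣ + ∣ ⊥ {n} ∣            ≡⟨ cong (∣ A zero ∪ U ∣ +_) (∣⊥∣≡0 n) ⟩
  ∣ A zero ∪ U ∣ + 0                    ≡⟨ +-identityʳ _ ⟩
  ∣ A zero ∪ U ∣                        ∎
  where
  open ≤-Reasoning
  U : Subset n
  U = ⋃ (tabulate (A ∘ suc))
  disj′ : Disjoint (A ∘ suc)
  disj′ i j x x∈Aᵢ x∈Aⱼ = suc-injectiveᶠ (disj (suc i) (suc j) x x∈Aᵢ x∈Aⱼ)
  A₀∩U-empty : Empty (A zero ∩ U)
  A₀∩U-empty (x , x∈A₀∩U) with x∈p∩q⁻ (A zero) U x∈A₀∩U
  ... | x∈A₀ , x∈U with x∈⋃⁻ m (A ∘ suc) x∈U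
  ...   | i , x∈Aᵢ with disj zero (suc i) x x∈A₀ x∈Aᵢ
  ...     | ()

module MatroidProperties {n : ℕ} (M : Matroid n) where
  open Matroid M

  r⊥≡0 : r ⊥ ≡ 0
  r⊥≡0 = n≤0⇒n≡0 (subst (r ⊥ ≤_) (∣⊥∣≡0 n) (r-bounded ⊥))

  r-subadditive : ∀ X Y → r (X ∪ Y) ≤ r X + r Y
  r-subadditive X Y = ≤-trans (m≤m+n _ _) (r-submod X Y)

  r-⋃≤sumFin : ∀ m (A : Fin m → Subset n) → r (⋃ (tabulate A)) ≤ sumFin m (r ∘ A)
  r-⋃≤sumFin zero    A = ≤-reflexive r⊥≡0
  r-⋃≤sumFin (suc m) A =
    ≤-trans (r-subadditive (A zero) _) (+-monoʳ-≤ (r (A zero)) (r-⋃≤sumFin m (A ∘ suc)))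

  r-≤-r+∣─∣ : ∀ X Y → X ⊆ Y → r Y ≤ r X + ∣ Y ─ X ∣
  r-≤-r+∣─∣ X Y X⊆Y = begin
    r Y               ≤⟨ r-mono Y (X ∪ (Y ─ X)) Y⊆X∪[Y─X] ⟩
    r (X ∪ (Y ─ X))   ≤⟨ r-subadditive X (Y ─ X) ⟩
    r X + r (Y ─ X)   ≤⟨ +-monoʳ-≤ (r X) (r-bounded (Y ─ X)) ⟩
    r X + ∣ Y ─ X ∣   ∎
    where
    open ≤-Reasoning
    Y⊆X∪[Y─X] : Y ⊆ X ∪ (Y ─ X)
    Y⊆X∪[Y─X] {x} x∈Y with x ∈? X
    ... | yes x∈X = x∈p∪q⁺ (inj₁ x∈X)
    ... | no  x∉X = x∈p∪q⁺ (inj₂ (x∈p∧x∉q⇒x∈p─q x∈Y x∉X))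

  r≤suc-r[-] : ∀ S {e} → e ∈ S → r S ≤ suc (r (S - e))
  r≤suc-r[-] S {e} e∈S = begin
    r S                         ≤⟨ r-≤-r+∣─∣ (S - e) S (p─q⊆p S ⁅ e ⁆) ⟩
    r (S - e) + ∣ S ─ (S - e) ∣ ≤⟨ +-monoʳ-≤ (r (S - e)) ∣S─[S-e]∣≤1 ⟩
    r (S - e) + 1               ≡⟨ +-comm (r (S - e)) 1 ⟩
    suc (r (S - e))             ∎
    where
    open ≤-Reasoning
    S─[S-e]⊆⁅e⁆ : S ─ (S - e) ⊆ ⁅ e ⁆
    S─[S-e]⊆⁅e⁆ {x} x∈S─[S-e] with x ≟ᶠ e
    ... | yes refl = x∈⁅x⁆ x
    ... | no  x≢e  = contradiction (x∈p∧x≢y⇒x∈p-y (p─q⊆p S _ x∈S─[S-e]) x≢e)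
                                   (x∈p─q⇒x∉q S (S - e) x∈S─[S-e])
    ∣S─[S-e]∣≤1 : ∣ S ─ (S - e) ∣ ≤ 1
    ∣S─[S-e]∣≤1 = subst (∣ S ─ (S - e) ∣ ≤_) (∣⁅x⁆∣≡1 e) (p⊆q⇒∣p∣≤∣q∣ S─[S-e]⊆⁅e⁆)

  nullity : Subset n → ℕ
  nullity X = ∣ X ∣ ∸ r X

  r+nullity≡∣∣ : ∀ X → r X + nullity X ≡ ∣ X ∣
  r+nullity≡∣∣ X = m+[n∸m]≡n (r-bounded X)

  r+k≡∣∣⇒nullity≡k : ∀ X {k} → r X + k ≡ ∣ X ∣ → nullity X ≡ k
  r+k≡∣∣⇒nullity≡k X r+k≡∣X∣ = +-cancelˡ-≡ (r X) _ _ (trans (r+nullity≡∣∣ X) (sym r+k≡∣X∣))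

  nullity≡k⇒r+k≡∣∣ : ∀ X {k} → nullity X ≡ k → r X + k ≡ ∣ X ∣
  nullity≡k⇒r+k≡∣∣ X refl = r+nullity≡∣∣ X

  nullity⊥≡0 : nullity ⊥ ≡ 0
  nullity⊥≡0 = cong₂ _∸_ (∣⊥∣≡0 n) r⊥≡0

  private
    a+b≡c+d∧a≤c⇒d≤b : ∀ {a b c d} → a + b ≡ c + d → a ≤ c → d ≤ b
    a+b≡c+d∧a≤c⇒d≤b {a} {b} {c} {d} eq a≤c =
      +-cancelˡ-≤ c d b (≤-trans (≤-reflexive (sym eq)) (+-monoˡ-≤ b a≤c))

  nullity-mono : ∀ X Y → X ⊆ Y → nullity X ≤ nullity Y
  nullity-mono X Y X⊆Y = a+b≡c+d∧a≤c⇒d≤b card (r-≤-r+∣─∣ X Y X⊆Y)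
    where
    open ≡-Reasoning
    card : r Y + nullity Y ≡ (r X + ∣ Y ─ X ∣) + nullity X
    card = begin
      r Y + nullity Y               ≡⟨ r+nullity≡∣∣ Y ⟩
      ∣ Y ∣                         ≡⟨ ∣p─q∣+∣q∣≡∣p∣ Y X X⊆Y ⟨
      ∣ Y ─ X ∣ + ∣ X ∣             ≡⟨ cong (∣ Y ─ X ∣ +_) (r+nullity≡∣∣ X) ⟨
      ∣ Y ─ X ∣ + (r X + nullity X) ≡⟨ +-assoc ∣ Y ─ X ∣ (r X) _ ⟨
      (∣ Y ─ X ∣ + r X) + nullity X ≡⟨ cong (_+ nullity X) (+-comm ∣ Y ─ X ∣ (r X)) ⟩
      (r X + ∣ Y ─ X ∣) + nullity X ∎

  nullity-supermod : ∀ X Y → nullity X + nullity Y ≤ nullity (X ∪ Y) + nullity (X ∩ Y)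
  nullity-supermod X Y = a+b≡c+d∧a≤c⇒d≤b card (r-submod X Y)
    where
    open ≡-Reasoning
    card : (r (X ∪ Y) + r (X ∩ Y)) + (nullity (X ∪ Y) + nullity (X ∩ Y))
         ≡ (r X + r Y) + (nullity X + nullity Y)
    card = begin
      (r (X ∪ Y) + r (X ∩ Y)) + (nullity (X ∪ Y) + nullity (X ∩ Y))
        ≡⟨ interchange (r (X ∪ Y)) _ _ _ ⟩
      (r (X ∪ Y) + nullity (X ∪ Y)) + (r (X ∩ Y) + nullity (X ∩ Y))
        ≡⟨ cong₂ _+_ (r+nullity≡∣∣ (X ∪ Y)) (r+nullity≡∣∣ (X ∩ Y)) ⟩
      ∣ X ∪ Y ∣ + ∣ X ∩ Y ∣
        ≡⟨ ∣p∪q∣+∣p∩q∣≡∣p∣+∣q∣ X Y ⟩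
      ∣ X ∣ + ∣ Y ∣
        ≡⟨ cong₂ _+_ (r+nullity≡∣∣ X) (r+nullity≡∣∣ Y) ⟨
      (r X + nullity X) + (r Y + nullity Y)
        ≡⟨ interchange (r X) _ _ _ ⟩
      (r X + r Y) + (nullity X + nullity Y) ∎

  nullity-superadditive : ∀ X Y → Empty (X ∩ Y) → nullity X + nullity Y ≤ nullity (X ∪ Y)
  nullity-superadditive X Y X∩Y-empty = begin
    nullity X + nullity Y             ≤⟨ nullity-supermod X Y ⟩
    nullity (X ∪ Y) + nullity (X ∩ Y) ≡⟨ cong (λ Z → nullity (X ∪ Y) + nullity Z) (Empty-unique X∩Y-empty) ⟩
    nullity (X ∪ Y) + nullity ⊥       ≡⟨ cong (nullity (X ∪ Y) +_) nullity⊥≡0 ⟩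
    nullity (X ∪ Y) + 0               ≡⟨ +-identityʳ _ ⟩
    nullity (X ∪ Y)                   ∎
    where open ≤-Reasoning

  nullity-[-]-rank-kept : ∀ S {e} → e ∈ S → r (S - e) ≡ r S → nullity S ≡ suc (nullity (S - e))
  nullity-[-]-rank-kept S {e} e∈S r≡ = r+k≡∣∣⇒nullity≡k S (begin
    r S + suc (nullity (S - e))       ≡⟨ cong (_+ suc (nullity (S - e))) r≡ ⟨
    r (S - e) + suc (nullity (S - e)) ≡⟨ +-suc (r (S - e)) _ ⟩
    suc (r (S - e) + nullity (S - e)) ≡⟨ cong suc (r+nullity≡∣∣ (S - e)) ⟩
    suc ∣ S - e ∣                     ≡⟨ +-comm 1 ∣ S - e ∣ ⟩
    ∣ S - e ∣ + 1                     ≡⟨ ∣p-x∣+1≡∣p∣ e∈S ⟩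
    ∣ S ∣                             ∎)
    where open ≡-Reasoning

  nullity-[-]-rank-dropped : ∀ S {e} → e ∈ S → r (S - e) ≢ r S → nullity (S - e) ≡ nullity S
  nullity-[-]-rank-dropped S {e} e∈S r≢ = r+k≡∣∣⇒nullity≡k (S - e) (suc-injective (begin
    suc (r (S - e) + nullity S) ≡⟨ cong (_+ nullity S) r≡ ⟨
    r S + nullity S             ≡⟨ r+nullity≡∣∣ S ⟩
    ∣ S ∣                       ≡⟨ ∣p-x∣+1≡∣p∣ e∈S ⟨
    ∣ S - e ∣ + 1               ≡⟨ +-comm ∣ S - e ∣ 1 ⟩
    suc ∣ S - e ∣               ∎))
    where
    open ≡-Reasoning
    r≡ : r S ≡ suc (r (S - e))
    r≡ = ≤-antisym (r≤suc-r[-] S e∈S) (≤∧≢⇒< (r-mono _ _ (p─q⊆p S ⁅ e ⁆)) r≢)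

  cyclic-core : ∀ S → ∃[ T ] (T ⊆ S × Cyclic M T × nullity T ≡ nullity S)
  cyclic-core S = go S (⊂-wellFounded S)
    where
    go : ∀ S → Acc _⊂_ S → ∃[ T ] (T ⊆ S × Cyclic M T × nullity T ≡ nullity S)
    go S (acc smaller) with any? (λ e → e ∈? S ×-dec ¬? (r (S - e) ≟ r S))
    ... | no ¬coloop = S , ⊆-refl , S-cyclic , refl
      where
      S-cyclic : Cyclic M S
      S-cyclic e e∈S with r (S - e) ≟ r S
      ... | yes r≡ = r≡
      ... | no  r≢ = contradiction (e , e∈S , r≢) ¬coloop
    ... | yes (e , e∈S , r≢) with go (S - e) (smaller (x∈p⇒p-x⊂p e∈S))
    ...   | T , T⊆S-e , T-cyclic , νT≡ =
      T , p─q⊆p S ⁅ e ⁆ ∘ T⊆S-e , T-cyclic , trans νT≡ (nullity-[-]-rank-dropped S e∈S r≢)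

  cyclic-max-nullity-⊆ : ∀ S B₁ B₂ → B₁ ⊆ S → B₂ ⊆ S → Cyclic M B₁
    → nullity B₁ ≡ nullity S → nullity B₂ ≡ nullity S → B₁ ⊆ B₂
  cyclic-max-nullity-⊆ S B₁ B₂ B₁⊆S B₂⊆S B₁-cyclic νB₁≡ νB₂≡ {y} y∈B₁ with y ∈? B₂
  ... | yes y∈B₂ = y∈B₂
  ... | no  y∉B₂ = contradiction (subst (_≤ nullity (B₁ - y)) νS≡ (+-cancelˡ-≤ (nullity S) _ _ 2νS≤)) 1+n≰n
    where
    open ≤-Reasoning
    νS≡ : nullity S ≡ suc (nullity (B₁ - y))
    νS≡ = trans (sym νB₁≡) (nullity-[-]-rank-kept B₁ y∈B₁ (B₁-cyclic y y∈B₁))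
    B₁∪B₂⊆S : B₁ ∪ B₂ ⊆ S
    B₁∪B₂⊆S x∈B₁∪B₂ with x∈p∪q⁻ B₁ B₂ x∈B₁∪B₂
    ... | inj₁ x∈B₁ = B₁⊆S x∈B₁
    ... | inj₂ x∈B₂ = B₂⊆S x∈B₂
    B₁∩B₂⊆B₁-y : B₁ ∩ B₂ ⊆ B₁ - y
    B₁∩B₂⊆B₁-y x∈B₁∩B₂ with x∈p∩q⁻ B₁ B₂ x∈B₁∩B₂
    ... | x∈B₁ , x∈B₂ = x∈p∧x≢y⇒x∈p-y x∈B₁ λ { refl → y∉B₂ x∈B₂ }
    2νS≤ : nullity S + nullity S ≤ nullity S + nullity (B₁ - y)
    2νS≤ = begin
      nullity S + nullity S
        ≡⟨ cong₂ _+_ νB₁≡ νB₂≡ ⟨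
      nullity B₁ + nullity B₂
        ≤⟨ nullity-supermod B₁ B₂ ⟩
      nullity (B₁ ∪ B₂) + nullity (B₁ ∩ B₂)
        ≤⟨ +-mono-≤ (nullity-mono _ _ B₁∪B₂⊆S) (nullity-mono _ _ B₁∩B₂⊆B₁-y) ⟩
      nullity S + nullity (B₁ - y) ∎

  nullity-⋂ : ∀ m S (B : Fin m → Subset n) → (∀ j → B j ⊆ S) → (∀ j → nullity S ≤ suc (nullity (B j)))
    → nullity S ≤ nullity (S ∩ ⋂ (tabulate B)) + m
  nullity-⋂ zero S B _ _ = begin
    nullity S           ≤⟨ nullity-mono S (S ∩ ⊤) (λ x∈S → x∈p∩q⁺ (x∈S , ∈⊤)) ⟩
    nullity (S ∩ ⊤)     ≡⟨ +-identityʳ _ ⟨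
    nullity (S ∩ ⊤) + 0 ∎
    where open ≤-Reasoning
  nullity-⋂ (suc m) S B B⊆S νS≤ = +-cancelˡ-≤ (nullity S) _ _ (begin
    nullity S + nullity S
      ≤⟨ +-mono-≤ (νS≤ zero) (nullity-⋂ m S (B ∘ suc) (B⊆S ∘ suc) (νS≤ ∘ suc)) ⟩
    suc (nullity B₀) + (nullity R + m)
      ≡⟨ cong suc (+-assoc (nullity B₀) _ m) ⟨
    suc (nullity B₀ + nullity R + m)
      ≡⟨ +-suc _ m ⟨
    (nullity B₀ + nullity R) + suc m
      ≤⟨ +-monoˡ-≤ (suc m) (nullity-supermod B₀ R) ⟩
    (nullity (B₀ ∪ R) + nullity (B₀ ∩ R)) + suc m
      ≤⟨ +-monoˡ-≤ (suc m) (+-mono-≤ (nullity-mono _ _ B₀∪R⊆S) (nullity-mono _ _ B₀∩R⊆I)) ⟩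
    (nullity S + nullity I) + suc m
      ≡⟨ +-assoc (nullity S) _ _ ⟩
    nullity S + (nullity I + suc m) ∎)
    where
    open ≤-Reasoning
    B₀ R I : Subset n
    B₀ = B zero
    R  = S ∩ ⋂ (tabulate (B ∘ suc))
    I  = S ∩ ⋂ (tabulate B)
    B₀∪R⊆S : B₀ ∪ R ⊆ S
    B₀∪R⊆S x∈B₀∪R with x∈p∪q⁻ B₀ R x∈B₀∪R
    ... | inj₁ x∈B₀ = B⊆S zero x∈B₀
    ... | inj₂ x∈R  = p∩q⊆p S _ x∈R
    B₀∩R⊆I : B₀ ∩ R ⊆ I
    B₀∩R⊆I x∈B₀∩R with x∈p∩q⁻ B₀ R x∈B₀∩R
    ... | x∈B₀ , x∈R with x∈p∩q⁻ S _ x∈R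
    ...   | x∈S , x∈⋂ = x∈p∩q⁺ (x∈S , x∈p∩q⁺ (x∈B₀ , x∈⋂))

  nullity≡0⇒Independent : ∀ X → nullity X ≡ 0 → Independent M X
  nullity≡0⇒Independent X ν≡0 = trans (sym (+-identityʳ (r X))) (nullity≡k⇒r+k≡∣∣ X ν≡0)

  Independent⇒nullity≡0 : ∀ X → Independent M X → nullity X ≡ 0
  Independent⇒nullity≡0 X indep = r+k≡∣∣⇒nullity≡k X (trans (+-identityʳ (r X)) indep)

  nullity-circuit : ∀ C → nullity C ≢ 0 → (∀ y → y ∈ C → nullity (C - y) ≡ 0) → Circuit M C
  nullity-circuit C νC≢0 ν[C-y]≡0 = νC≢0 ∘ Independent⇒nullity≡0 C , proper-independent
    where
    proper-independent : ∀ X → X ⊂ C → Independent M X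
    proper-independent X (X⊆C , y , y∈C , y∉X) = nullity≡0⇒Independent X (n≤0⇒n≡0
      (subst (nullity X ≤_) (ν[C-y]≡0 y y∈C) (nullity-mono X (C - y) X⊆C-y)))
      where
      X⊆C-y : X ⊆ C - y
      X⊆C-y x∈X = x∈p∧x≢y⇒x∈p-y (X⊆C x∈X) λ { refl → y∉X x∈X }

  r-∩-skew : ∀ P Q → r P + r Q ≤ r (P ∪ Q) → ∀ X → r (X ∩ P) + r (X ∩ Q) ≤ r X
  r-∩-skew P Q skew X = +-cancelʳ-≤ (r P + r Q) _ _ (begin
    (r (X ∩ P) + r (X ∩ Q)) + (r P + r Q)
      ≤⟨ +-monoʳ-≤ (r (X ∩ P) + r (X ∩ Q)) (≤-trans skew (r-mono _ _ P∪Q⊆XP∪Q)) ⟩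
    (r (X ∩ P) + r (X ∩ Q)) + r (XP ∪ Q)
      ≤⟨ +-monoˡ-≤ (r (XP ∪ Q)) (+-monoʳ-≤ (r (X ∩ P)) (r-mono _ _ X∩Q⊆XP∩Q)) ⟩
    (r (X ∩ P) + r (XP ∩ Q)) + r (XP ∪ Q)
      ≡⟨ +-assoc (r (X ∩ P)) _ _ ⟩
    r (X ∩ P) + (r (XP ∩ Q) + r (XP ∪ Q))
      ≡⟨ cong (r (X ∩ P) +_) (+-comm (r (XP ∩ Q)) _) ⟩
    r (X ∩ P) + (r (XP ∪ Q) + r (XP ∩ Q))
      ≤⟨ +-monoʳ-≤ (r (X ∩ P)) (r-submod XP Q) ⟩
    r (X ∩ P) + (r XP + r Q)
      ≡⟨ +-assoc (r (X ∩ P)) _ _ ⟨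
    (r (X ∩ P) + r XP) + r Q
      ≡⟨ cong (_+ r Q) (+-comm (r (X ∩ P)) _) ⟩
    (r XP + r (X ∩ P)) + r Q
      ≤⟨ +-monoˡ-≤ (r Q) (r-submod X P) ⟩
    (r X + r P) + r Q
      ≡⟨ +-assoc (r X) _ _ ⟩
    r X + (r P + r Q) ∎)
    where
    open ≤-Reasoning
    XP : Subset n
    XP = X ∪ P
    P∪Q⊆XP∪Q : P ∪ Q ⊆ XP ∪ Q
    P∪Q⊆XP∪Q x∈P∪Q with x∈p∪q⁻ P Q x∈P∪Q
    ... | inj₁ x∈P = x∈p∪q⁺ (inj₁ (x∈p∪q⁺ (inj₂ x∈P)))
    ... | inj₂ x∈Q = x∈p∪q⁺ (inj₂ x∈Q)
    X∩Q⊆XP∩Q : X ∩ Q ⊆ XP ∩ Q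
    X∩Q⊆XP∩Q x∈X∩Q with x∈p∩q⁻ X Q x∈X∩Q
    ... | x∈X , x∈Q = x∈p∩q⁺ (x∈p∪q⁺ (inj₁ x∈X) , x∈Q)

  r≤sumFin-r∩ : ∀ m (A : Fin m → Subset n) X → X ⊆ ⋃ (tabulate A) → r X ≤ sumFin m (λ i → r (X ∩ A i))
  r≤sumFin-r∩ m A X X⊆⋃A = ≤-trans (r-mono X _ X⊆⋃X∩A) (r-⋃≤sumFin m (λ i → X ∩ A i))
    where
    X⊆⋃X∩A : X ⊆ ⋃ (tabulate (λ i → X ∩ A i))
    X⊆⋃X∩A x∈X with x∈⋃⁻ m A (X⊆⋃A x∈X)
    ... | i , x∈Aᵢ = x∈⋃⁺ (λ i → X ∩ A i) i (x∈p∩q⁺ (x∈X , x∈Aᵢ))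

  sumFin-r∩≤r : ∀ m (A : Fin m → Subset n) → sumFin m (r ∘ A) ≤ r (⋃ (tabulate A))
    → ∀ X → sumFin m (λ i → r (X ∩ A i)) ≤ r X
  sumFin-r∩≤r zero    A _    X = z≤n
  sumFin-r∩≤r (suc m) A skew X = begin
    r (X ∩ A zero) + sumFin m (λ i → r (X ∩ A (suc i)))
      ≤⟨ +-monoʳ-≤ (r (X ∩ A zero)) (sumFin-mono-≤ m λ i → r-mono _ _ (X∩Aᵢ⊆[X∩U]∩Aᵢ i)) ⟩
    r (X ∩ A zero) + sumFin m (λ i → r ((X ∩ U) ∩ A (suc i)))
      ≤⟨ +-monoʳ-≤ (r (X ∩ A zero)) (sumFin-r∩≤r m (A ∘ suc) skew-U (X ∩ U)) ⟩
    r (X ∩ A zero) + r (X ∩ U)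
      ≤⟨ r-∩-skew (A zero) U skew-A₀-U X ⟩
    r X ∎
    where
    open ≤-Reasoning
    U : Subset n
    U = ⋃ (tabulate (A ∘ suc))
    skew-U : sumFin m (r ∘ A ∘ suc) ≤ r U
    skew-U = +-cancelˡ-≤ (r (A zero)) _ _ (≤-trans skew (r-subadditive (A zero) U))
    skew-A₀-U : r (A zero) + r U ≤ r (A zero ∪ U)
    skew-A₀-U = ≤-trans (+-monoʳ-≤ (r (A zero)) (r-⋃≤sumFin m (A ∘ suc))) skew
    X∩Aᵢ⊆[X∩U]∩Aᵢ : ∀ i → X ∩ A (suc i) ⊆ (X ∩ U) ∩ A (suc i)
    X∩Aᵢ⊆[X∩U]∩Aᵢ i x∈X∩Aᵢ with x∈p∩q⁻ X (A (suc i)) x∈X∩Aᵢ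
    ... | x∈X , x∈Aᵢ = x∈p∩q⁺ (x∈p∩q⁺ (x∈X , x∈⋃⁺ (A ∘ suc) i x∈Aᵢ) , x∈Aᵢ)

  FoldCircuit⇒nullity≡ : ∀ {k D} → FoldCircuit M k D → nullity D ≡ k
  FoldCircuit⇒nullity≡ {D = D} (_ , r+k≡∣D∣) = r+k≡∣∣⇒nullity≡k D r+k≡∣D∣

  nullity[D-x]≡k : ∀ {k D x} → FoldCircuit M (suc k) D → x ∈ D → nullity (D - x) ≡ k
  nullity[D-x]≡k {D = D} D-fold@(D-cyclic , _) x∈D = suc-injective
    (trans (sym (nullity-[-]-rank-kept D x∈D (D-cyclic _ x∈D))) (FoldCircuit⇒nullity≡ D-fold))

  fold-circuit-avoiding : ∀ {k D x} → FoldCircuit M (suc k) D → x ∈ D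
    → ∃[ B ] (B ⊆ D - x × FoldCircuit M k B)
  fold-circuit-avoiding {D = D} {x} D-fold x∈D with cyclic-core (D - x)
  ... | B , B⊆D-x , B-cyclic , νB≡ =
    B , B⊆D-x , B-cyclic , nullity≡k⇒r+k≡∣∣ B (trans νB≡ (nullity[D-x]≡k D-fold x∈D))

  fold-circuit-avoiding-unique : ∀ {k D x B₁ B₂} → FoldCircuit M (suc k) D → x ∈ D
    → B₁ ⊆ D - x → B₂ ⊆ D - x → FoldCircuit M k B₁ → FoldCircuit M k B₂ → B₁ ≡ B₂
  fold-circuit-avoiding-unique {D = D} {x} {B₁} {B₂} D-fold x∈D B₁⊆ B₂⊆ B₁-fold B₂-fold =
    ⊆-antisym (cyclic-max-nullity-⊆ (D - x) B₁ B₂ B₁⊆ B₂⊆ (proj₁ B₁-fold) νB₁≡ νB₂≡)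
              (cyclic-max-nullity-⊆ (D - x) B₂ B₁ B₂⊆ B₁⊆ (proj₁ B₂-fold) νB₂≡ νB₁≡)
    where
    νB₁≡ : nullity B₁ ≡ nullity (D - x)
    νB₁≡ = trans (FoldCircuit⇒nullity≡ B₁-fold) (sym (nullity[D-x]≡k D-fold x∈D))
    νB₂≡ : nullity B₂ ≡ nullity (D - x)
    νB₂≡ = trans (FoldCircuit⇒nullity≡ B₂-fold) (sym (nullity[D-x]≡k D-fold x∈D))

module PrincipalPartition {n : ℕ} (M : Matroid n) (k : ℕ) (D : Subset n) (D-fold : FoldCircuit M (suc k) D)
  (A : Fin (suc k) → Subset n) (A-injective : Injective _≡_ _≡_ A)
  (A-parts : ∀ X → PrincipalPart M k D X ⇔ (∃[ i ] X ≡ A i)) where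
  open Matroid M
  open MatroidProperties M

  private
    part : ∀ i → PrincipalPart M k D (A i)
    part i = Equivalence.from (A-parts (A i)) (i , refl)

  B : Fin (suc k) → Subset n
  B i = proj₁ (part i)

  B⊆D : ∀ i → B i ⊆ D
  B⊆D i = proj₁ (proj₂ (part i))

  B-fold : ∀ i → FoldCircuit M k (B i)
  B-fold i = proj₁ (proj₂ (proj₂ (part i)))

  A≡D─B : ∀ i → A i ≡ D ─ B i
  A≡D─B i = proj₂ (proj₂ (proj₂ (part i)))

  x∈A⇒x∈D : ∀ {i x} → x ∈ A i → x ∈ D
  x∈A⇒x∈D {i} x∈A = p─q⊆p D (B i) (subst (_ ∈_) (A≡D─B i) x∈A)

  x∈A⇒x∉B : ∀ {i x} → x ∈ A i → x ∉ B i
  x∈A⇒x∉B {i} x∈A = x∈p─q⇒x∉q D (B i) (subst (_ ∈_) (A≡D─B i) x∈A)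

  B⊆D-x : ∀ {i x} → x ∈ A i → B i ⊆ D - x
  B⊆D-x {i} x∈A y∈B = x∈p∧x≢y⇒x∈p-y (B⊆D i y∈B) λ { refl → x∈A⇒x∉B x∈A y∈B }

  A-cover : ∀ x → x ∈ D → ∃[ i ] x ∈ A i
  A-cover x x∈D with fold-circuit-avoiding D-fold x∈D
  ... | B′ , B′⊆D-x , B′-fold with Equivalence.to (A-parts (D ─ B′)) (B′ , p─q⊆p D ⁅ x ⁆ ∘ B′⊆D-x , B′-fold , refl)
  ...   | i , D─B′≡A = i , subst (x ∈_) D─B′≡A (x∈p∧x∉q⇒x∈p─q x∈D x∉B′)
    where
    x∉B′ : x ∉ B′
    x∉B′ x∈B′ = x∈p─q⇒x∉q D ⁅ x ⁆ (B′⊆D-x x∈B′) (x∈⁅x⁆ x)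

  A-disjoint : Disjoint A
  A-disjoint i j x x∈Aᵢ x∈Aⱼ = A-injective (begin
    A i     ≡⟨ A≡D─B i ⟩
    D ─ B i ≡⟨ cong (D ─_) (fold-circuit-avoiding-unique D-fold (x∈A⇒x∈D x∈Aᵢ)
                 (B⊆D-x x∈Aᵢ) (B⊆D-x x∈Aⱼ) (B-fold i) (B-fold j)) ⟩
    D ─ B j ≡⟨ A≡D─B j ⟨
    A j     ∎)
    where open ≡-Reasoning

  nullity+k≤nullity : ∀ i X S → X ⊆ A i → X ⊆ S → B i ⊆ S → nullity X + k ≤ nullity S
  nullity+k≤nullity i X S X⊆A X⊆S B⊆S = begin
    nullity X + k             ≡⟨ cong (nullity X +_) (FoldCircuit⇒nullity≡ (B-fold i)) ⟨
    nullity X + nullity (B i) ≤⟨ nullity-superadditive X (B i) X∩B-empty ⟩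
    nullity (X ∪ B i)         ≤⟨ nullity-mono _ _ X∪B⊆S ⟩
    nullity S                 ∎
    where
    open ≤-Reasoning
    X∩B-empty : Empty (X ∩ B i)
    X∩B-empty (x , x∈X∩B) with x∈p∩q⁻ X (B i) x∈X∩B
    ... | x∈X , x∈B = x∈A⇒x∉B (X⊆A x∈X) x∈B
    X∪B⊆S : X ∪ B i ⊆ S
    X∪B⊆S x∈X∪B with x∈p∪q⁻ X (B i) x∈X∪B
    ... | inj₁ x∈X = X⊆S x∈X
    ... | inj₂ x∈B = B⊆S x∈B

  nullity-A≤1 : ∀ i → nullity (A i) ≤ 1
  nullity-A≤1 i = +-cancelʳ-≤ k _ _ (≤-trans (nullity+k≤nullity i (A i) D ⊆-refl x∈A⇒x∈D (B⊆D i))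
                                            (≤-reflexive (FoldCircuit⇒nullity≡ D-fold)))

  nullity[A-y]≡0 : ∀ i y → y ∈ A i → nullity (A i - y) ≡ 0
  nullity[A-y]≡0 i y y∈A = n≤0⇒n≡0 (+-cancelʳ-≤ k _ 0
    (≤-trans (nullity+k≤nullity i (A i - y) (D - y) (p─q⊆p (A i) ⁅ y ⁆) A-y⊆D-y (B⊆D-x y∈A))
             (≤-reflexive (nullity[D-x]≡k D-fold (x∈A⇒x∈D y∈A)))))
    where
    A-y⊆D-y : A i - y ⊆ D - y
    A-y⊆D-y x∈A-y = x∈p∧x≢y⇒x∈p-y (x∈A⇒x∈D (p─q⊆p (A i) ⁅ y ⁆ x∈A-y))
                                  (x∉⁅y⁆⇒x≢y (x∈p─q⇒x∉q (A i) ⁅ y ⁆ x∈A-y))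

  -- The complements of the k other parts meet inside A i, since the parts cover D, and
  -- each of the k intersections costs at most one unit of nullity: this is where the
  -- number k+1 of parts is used.
  1≤nullity-A : ∀ i → 1 ≤ nullity (A i)
  1≤nullity-A i = +-cancelʳ-≤ k _ _ (begin
    suc k                  ≡⟨ FoldCircuit⇒nullity≡ D-fold ⟨
    nullity D              ≤⟨ nullity-⋂ k D (B ∘ punchIn i) (B⊆D ∘ punchIn i) νD≤suc-νB ⟩
    nullity ⋂B′ + k        ≤⟨ +-monoˡ-≤ k (nullity-mono ⋂B′ (A i) ⋂B′⊆A) ⟩
    nullity (A i) + k      ∎)
    where
    open ≤-Reasoning
    ⋂B′ : Subset n
    ⋂B′ = D ∩ ⋂ (tabulate (B ∘ punchIn i))
    νD≤suc-νB : ∀ j → nullity D ≤ suc (nullity (B (punchIn i j)))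
    νD≤suc-νB j = ≤-reflexive (trans (FoldCircuit⇒nullity≡ D-fold)
                                     (cong suc (sym (FoldCircuit⇒nullity≡ (B-fold (punchIn i j))))))
    ⋂B′⊆A : ⋂B′ ⊆ A i
    ⋂B′⊆A {x} x∈⋂B′ with x∈p∩q⁻ D _ x∈⋂B′
    ... | x∈D , x∈⋂ with A-cover x x∈D
    ...   | l , x∈Aₗ with i ≟ᶠ l
    ...     | yes refl = x∈Aₗ
    ...     | no  i≢l  = contradiction (subst (λ j → x ∈ B j) (punchIn-punchOut i≢l)
                                              (x∈⋂⁻ (B ∘ punchIn i) x∈⋂ (punchOut i≢l)))
                                       (x∈A⇒x∉B x∈Aₗ)

  nullity-A≡1 : ∀ i → nullity (A i) ≡ 1
  nullity-A≡1 i = ≤-antisym (nullity-A≤1 i) (1≤nullity-A i)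

  A-circuit : ∀ i → Circuit M (A i)
  A-circuit i = nullity-circuit (A i) (λ ν≡0 → 0≢1+n (trans (sym ν≡0) (nullity-A≡1 i))) (nullity[A-y]≡0 i)

  D⊆⋃A : D ⊆ ⋃ (tabulate A)
  D⊆⋃A {x} x∈D with A-cover x x∈D
  ... | i , x∈A = x∈⋃⁺ A i x∈A

  ⋃A⊆D : ⋃ (tabulate A) ⊆ D
  ⋃A⊆D {x} x∈⋃A with x∈⋃⁻ (suc k) A x∈⋃A
  ... | i , x∈A = x∈A⇒x∈D x∈A

  sumFin-r-A≤r-⋃A : sumFin (suc k) (r ∘ A) ≤ r (⋃ (tabulate A))
  sumFin-r-A≤r-⋃A = +-cancelʳ-≤ (suc k) _ _ (begin
    sumFin (suc k) (r ∘ A) + suc k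
      ≡⟨ cong (sumFin (suc k) (r ∘ A) +_) (trans (sumFin-const (suc k) nullity-A≡1) (*-identityʳ (suc k))) ⟨
    sumFin (suc k) (r ∘ A) + sumFin (suc k) (nullity ∘ A)
      ≡⟨ sumFin-+ (suc k) (r ∘ A) (nullity ∘ A) ⟨
    sumFin (suc k) (λ i → r (A i) + nullity (A i))
      ≤⟨ sumFin-mono-≤ (suc k) (λ i → ≤-reflexive (r+nullity≡∣∣ (A i))) ⟩
    sumFin (suc k) (∣_∣ ∘ A)
      ≤⟨ sumFin-∣∣≤∣⋃∣ (suc k) A A-disjoint ⟩
    ∣ ⋃A ∣
      ≡⟨ r+nullity≡∣∣ ⋃A ⟨
    r ⋃A + nullity ⋃A
      ≤⟨ +-monoʳ-≤ (r ⋃A) (nullity-mono ⋃A D ⋃A⊆D) ⟩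
    r ⋃A + nullity D
      ≡⟨ cong (r ⋃A +_) (FoldCircuit⇒nullity≡ D-fold) ⟩
    r ⋃A + suc k ∎)
    where
    open ≤-Reasoning
    ⋃A : Subset n
    ⋃A = ⋃ (tabulate A)

  r-decompose : ∀ X → X ⊆ D → r X ≡ sumFin (suc k) (λ i → r (X ∩ A i))
  r-decompose X X⊆D = ≤-antisym (r≤sumFin-r∩ (suc k) A X (D⊆⋃A ∘ X⊆D))
                                (sumFin-r∩≤r (suc k) A sumFin-r-A≤r-⋃A X)

mainTheorem16 : ∀ {n : ℕ} (M : Matroid n) (k : ℕ) (D : Subset n)
    → FoldCircuit M (suc k) D
    → (A : Fin (suc k) → Subset n)
    → Injective _≡_ _≡_ A
    → (∀ X → PrincipalPart M k D X ⇔ (∃[ i ] X ≡ A i))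
    → (∀ i → Circuit M (A i))
      × ((∀ x → x ∈ D ⇔ (∃[ i ] x ∈ A i))
         × (∀ i j x → x ∈ A i → x ∈ A j → i ≡ j)
         × (∀ X → X ⊆ D → Matroid.r M X ≡ sumFin (suc k) (λ i → Matroid.r M (X ∩ A i))))
mainTheorem16 M k D D-fold A A-injective A-parts =
  A-circuit , (λ x → mk⇔ (A-cover x) (x∈A⇒x∈D ∘ proj₂)) , A-disjoint , r-decompose
  where open PrincipalPartition M k D D-fold A A-injective A-parts
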